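{- For every $\Sigma$-sentence $\phi$ of $\mathcal{L}_{BT}$: if $\mathfrak{F}\models\phi$, then $F\vdash\phi$.
   Context: Bit strings are elements of $\{\mathbf{0},\mathbf{1}\}^*$; $\varepsilon$ is the empty string, $|\alpha|$ the length. The language $\mathcal{L}_{BT}$ has constant symbols $e,0,1$, binary function symbol $\circ$ (also written as juxtaposition), and binary relation symbol $\sqsubseteq$. The structure $\mathfrak{F}$ has universe $\{\mathbf{0},\mathbf{1}\}^*$, interprets $e,0,1$ as $\varepsilon,\mathbf{0},\mathbf{1}$, $\circ$ as concatenation, and $\alpha\sqsubseteq\beta$ as $|\alpha|\le|\beta|$. $(\exists x\sqsubseteq t)\phi$ abbreviates $\exists x[x\sqsubseteq t\wedge\phi]$, $(\forall x\sqsubseteq t)\phi$ abbreviates $\forall x[x\sqsubseteq t\to\phi]$. $\Sigma$-formulas: $s\sqsubseteq t$, $\neg s\sqsubseteq t$, $s=t$, $\neg s=t$ (terms $s,t$) are $\Sigma$-formulas; they are closed under $\wedge,\vee$, and under $(\exists x\sqsubseteq t)$, $(\forall x\sqsubseteq t)$ and $\exists x$ where $x$ does not occur in $t$. The theory $F$ has the axioms: (1) $\forall x[x=ex\wedge x=xe]$; (2) $\forall xyz[(xy)z=x(yz)]$; (3) $\forall xy[x\neq y\to(x0\neq y0\wedge x1\neq y1)]$; (4) $\forall xy[x0\neq y1]$; (5) $\forall x[e\sqsubseteq x]$; (6) $\forall x[x\sqsubseteq e\to x=e]$; (7)–(10): for each $a,b\in\{0,1\}$, $\forall xy[xa\sqsubseteq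 yb\leftrightarrow x\sqsubseteq y]$; (11) $\forall x[x=e\vee\exists y[x=y0\vee x=y1]]$. -}

module Defs where

open import Data.Nat using (ℕ; zero; suc; _≤_)
open import Data.Fin using (Fin; zero; suc)
open import Data.Bool using (Bool; true; false)
open import Data.List using (List; []; _∷_; _++_; length; map)
open import Data.List.Membership.Propositional using (_∈_)
open import Data.Product using (Σ; _×_)
open import Data.Sum using (_⊎_)
open import Data.Empty using (⊥)
open import Relation.Binary.PropositionalEquality using (_≡_)

infixl 9 _·_
data Term (n : ℕ) : Set where
  var : Fin n → Term n
  e   : Term n
  𝟘   : Term n
  𝟙   : Term n
  _·_ : Term n → Term n → Term n

infix  7 _≐_ _⊑̇_
infixr 6 _∧̇_
infixr 5 _∨̇_
infixr 4 _⇒_ _⇔_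
data Formula (n : ℕ) : Set where
  ⊥̇         : Formula n
  _≐_ _⊑̇_   : Term n → Term n → Formula n
  _⇒_ _∧̇_ _∨̇_ : Formula n → Formula n → Formula n
  ∀̇ ∃̇       : Formula (suc n) → Formula n

¬̇_ : ∀ {n} → Formula n → Formula n
¬̇ φ = φ ⇒ ⊥̇

_⇔_ : ∀ {n} → Formula n → Formula n → Formula n
φ ⇔ ψ = (φ ⇒ ψ) ∧̇ (ψ ⇒ φ)

substT : ∀ {n m} → (Fin n → Term m) → Term n → Term m
substT σ (var i) = σ i
substT σ e = e
substT σ 𝟘 = 𝟘
substT σ 𝟙 = 𝟙
substT σ (s · t) = substT σ s · substT σ t

wkT : ∀ {n} → Term n → Term (suc n)
wkT = substT (λ i → var (suc i))

exts : ∀ {n m} → (Fin n → Term m) → Fin (suc n) → Term (suc m)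
exts σ zero = var zero
exts σ (suc i) = wkT (σ i)

substF : ∀ {n m} → (Fin n → Term m) → Formula n → Formula m
substF σ ⊥̇ = ⊥̇
substF σ (s ≐ t) = substT σ s ≐ substT σ t
substF σ (s ⊑̇ t) = substT σ s ⊑̇ substT σ t
substF σ (φ ⇒ ψ) = substF σ φ ⇒ substF σ ψ
substF σ (φ ∧̇ ψ) = substF σ φ ∧̇ substF σ ψ
substF σ (φ ∨̇ ψ) = substF σ φ ∨̇ substF σ ψ
substF σ (∀̇ φ) = ∀̇ (substF (exts σ) φ)
substF σ (∃̇ φ) = ∃̇ (substF (exts σ) φ)

wkF : ∀ {n} → Formula n → Formula (suc n)
wkF = substF (λ i → var (suc i))

_[_] : ∀ {n} → Formula (suc n) → Term n → Formula n
φ [ t ] = substF σ φ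
  where
  σ : _ → _
  σ zero = t
  σ (suc i) = var i

closed : ∀ {n} → Formula 0 → Formula n
closed = substF (λ ())

-- Σ-formulas.  The bounded quantifiers (∃x ⊑ t), (∀x ⊑ t) abbreviate
-- ∃x[x ⊑ t ∧ φ] and ∀x[x ⊑ t → φ]; the side condition "x does not occur
-- in t" is enforced by t being a weakened term (wkT t).

data IsΣ {n : ℕ} : Formula n → Set where
  ⊑-atom  : ∀ s t → IsΣ (s ⊑̇ t)
  ⊑-neg   : ∀ s t → IsΣ (¬̇ (s ⊑̇ t))
  ≐-atom  : ∀ s t → IsΣ (s ≐ t)
  ≐-neg   : ∀ s t → IsΣ (¬̇ (s ≐ t))
  ∧-Σ     : ∀ {φ ψ} → IsΣ φ → IsΣ ψ → IsΣ (φ ∧̇ ψ)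
  ∨-Σ     : ∀ {φ ψ} → IsΣ φ → IsΣ ψ → IsΣ (φ ∨̇ ψ)
  b∃-Σ    : ∀ (t : Term n) {φ} → IsΣ φ → IsΣ (∃̇ ((var zero ⊑̇ wkT t) ∧̇ φ))
  b∀-Σ    : ∀ (t : Term n) {φ} → IsΣ φ → IsΣ (∀̇ ((var zero ⊑̇ wkT t) ⇒ φ))
  ∃-Σ     : ∀ {φ} → IsΣ φ → IsΣ (∃̇ φ)

BitString : Set
BitString = List Bool

Env : ℕ → Set
Env n = Fin n → BitString

_∷ₑ_ : ∀ {n} → BitString → Env n → Env (suc n)
(x ∷ₑ ρ) zero = x
(x ∷ₑ ρ) (suc i) = ρ i

⟦_⟧ₜ : ∀ {n} → Term n → Env n → BitString
⟦ var i ⟧ₜ ρ = ρ i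
⟦ e ⟧ₜ ρ = []
⟦ 𝟘 ⟧ₜ ρ = false ∷ []
⟦ 𝟙 ⟧ₜ ρ = true ∷ []
⟦ s · t ⟧ₜ ρ = ⟦ s ⟧ₜ ρ ++ ⟦ t ⟧ₜ ρ

_⊨_ : ∀ {n} → Env n → Formula n → Set
ρ ⊨ ⊥̇ = ⊥
ρ ⊨ (s ≐ t) = ⟦ s ⟧ₜ ρ ≡ ⟦ t ⟧ₜ ρ
ρ ⊨ (s ⊑̇ t) = length (⟦ s ⟧ₜ ρ) ≤ length (⟦ t ⟧ₜ ρ)
ρ ⊨ (φ ⇒ ψ) = ρ ⊨ φ → ρ ⊨ ψ
ρ ⊨ (φ ∧̇ ψ) = ρ ⊨ φ × ρ ⊨ ψ
ρ ⊨ (φ ∨̇ ψ) = ρ ⊨ φ ⊎ ρ ⊨ ψ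
ρ ⊨ ∀̇ φ = (x : BitString) → (x ∷ₑ ρ) ⊨ φ
ρ ⊨ ∃̇ φ = Σ BitString (λ x → (x ∷ₑ ρ) ⊨ φ)

𝔉⊨_ : Formula 0 → Set
𝔉⊨ φ = (λ ()) ⊨ φ

private
  v0 : ∀ {n} → Term (suc n)
  v0 = var zero
  v1 : ∀ {n} → Term (suc (suc n))
  v1 = var (suc zero)
  v2 : ∀ {n} → Term (suc (suc (suc n)))
  v2 = var (suc (suc zero))

bit : ∀ {n} → Bool → Term n
bit false = 𝟘
bit true  = 𝟙

data AxF : Formula 0 → Set where
  ax1  : AxF (∀̇ ((v0 ≐ e · v0) ∧̇ (v0 ≐ v0 · e)))
  ax2  : AxF (∀̇ (∀̇ (∀̇ ((v2 · v1) · v0 ≐ v2 · (v1 · v0)))))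
  ax3  : AxF (∀̇ (∀̇ (¬̇ (v1 ≐ v0) ⇒ (¬̇ (v1 · 𝟘 ≐ v0 · 𝟘) ∧̇ ¬̇ (v1 · 𝟙 ≐ v0 · 𝟙)))))
  ax4  : AxF (∀̇ (∀̇ (¬̇ (v1 · 𝟘 ≐ v0 · 𝟙))))
  ax5  : AxF (∀̇ (e ⊑̇ v0))
  ax6  : AxF (∀̇ ((v0 ⊑̇ e) ⇒ (v0 ≐ e)))
  ax7-10 : (a b : Bool) → AxF (∀̇ (∀̇ ((v1 · bit a ⊑̇ v0 · bit b) ⇔ (v1 ⊑̇ v0))))
  ax11 : AxF (∀̇ ((v0 ≐ e) ∨̇ ∃̇ ((v1 ≐ v0 · 𝟘) ∨̇ (v1 ≐ v0 · 𝟙))))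

infix 2 _⊢_
data _⊢_ {n : ℕ} : List (Formula n) → Formula n → Set where
  hyp  : ∀ {Γ φ} → φ ∈ Γ → Γ ⊢ φ
  ax   : ∀ {Γ ψ} → AxF ψ → Γ ⊢ closed ψ
  ⇒I   : ∀ {Γ φ ψ} → (φ ∷ Γ) ⊢ ψ → Γ ⊢ φ ⇒ ψ
  ⇒E   : ∀ {Γ φ ψ} → Γ ⊢ φ ⇒ ψ → Γ ⊢ φ → Γ ⊢ ψ
  ∧I   : ∀ {Γ φ ψ} → Γ ⊢ φ → Γ ⊢ ψ → Γ ⊢ φ ∧̇ ψ
  ∧E₁  : ∀ {Γ φ ψ} → Γ ⊢ φ ∧̇ ψ → Γ ⊢ φ
  ∧E₂  : ∀ {Γ φ ψ} → Γ ⊢ φ ∧̇ ψ → Γ ⊢ ψ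
  ∨I₁  : ∀ {Γ φ ψ} → Γ ⊢ φ → Γ ⊢ φ ∨̇ ψ
  ∨I₂  : ∀ {Γ φ ψ} → Γ ⊢ ψ → Γ ⊢ φ ∨̇ ψ
  ∨E   : ∀ {Γ φ ψ χ} → Γ ⊢ φ ∨̇ ψ → (φ ∷ Γ) ⊢ χ → (ψ ∷ Γ) ⊢ χ → Γ ⊢ χ
  raa  : ∀ {Γ φ} → (¬̇ φ ∷ Γ) ⊢ ⊥̇ → Γ ⊢ φ
  ∀I   : ∀ {Γ φ} → map wkF Γ ⊢ φ → Γ ⊢ ∀̇ φ
  ∀E   : ∀ {Γ φ} → Γ ⊢ ∀̇ φ → (t : Term n) → Γ ⊢ φ [ t ]
  ∃I   : ∀ {Γ φ} → (t : Term n) → Γ ⊢ φ [ t ] → Γ ⊢ ∃̇ φ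
  ∃E   : ∀ {Γ φ ψ} → Γ ⊢ ∃̇ φ → (φ ∷ map wkF Γ) ⊢ wkF ψ → Γ ⊢ ψ
  ≐refl : ∀ {Γ} (t : Term n) → Γ ⊢ t ≐ t
  ≐subst : ∀ {Γ s t} (φ : Formula (suc n)) → Γ ⊢ s ≐ t → Γ ⊢ φ [ s ] → Γ ⊢ φ [ t ]

F⊢_ : Formula 0 → Set
F⊢ φ = [] ⊢ φ

-- Every Σ-sentence true in 𝔉 is provable because F decides all closed atomic
-- sentences about numerals: equalities via axioms 1–4, length comparisons via
-- axioms 5–10.  One then proves, by induction on Σ-formulas, that each instance
-- by numerals of a true Σ-formula is provable; the witnesses of ∃ are numerals,
-- and a bounded ∀x ⊑ ⌜β⌝ reduces, via axiom 11, to the finitely many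
-- instances x = ⌜α⌝ with |α| ≤ |β|.
module Submission where

open import Defs
open import Data.Nat using (ℕ; zero; suc; _≤_; _<_; z≤n; s≤s)
open import Data.Nat.Properties using (≰⇒>)
open import Data.Fin using (Fin; zero; suc)
open import Data.Bool using (Bool; true; false)
open import Data.List using (List; []; _∷_; _++_; length; map; reverse)
open import Data.List.Properties using (reverse-++; reverse-involutive; reverse-injective; length-reverse)
open import Data.List.Membership.Propositional using (_∈_)
open import Data.List.Membership.Propositional.Properties using (∈-map⁺; ∈-map⁻; ∈-++⁻)
open import Data.List.Relation.Binary.Subset.Propositional using (_⊆_)
open import Data.List.Relation.Binary.Subset.Propositional.Properties
  using (∷⁺ʳ; map⁺; xs⊆x∷xs; xs⊆xs++ys; xs⊆ys++xs)
open import Data.List.Relation.Unary.Any using (here; there)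
open import Data.Product using (_,_)
open import Data.Sum using (inj₁; inj₂)
open import Data.Empty using (⊥-elim)
open import Relation.Nullary using (¬_)
open import Function using (_∘_)
open import Relation.Binary.PropositionalEquality hiding ([_])

Subst : ℕ → ℕ → Set
Subst n m = Fin n → Term m

substT-cong : ∀ {n m} {σ τ : Subst n m} → (∀ i → σ i ≡ τ i) → ∀ t → substT σ t ≡ substT τ t
substT-cong h (var i) = h i
substT-cong h e = refl
substT-cong h 𝟘 = refl
substT-cong h 𝟙 = refl
substT-cong h (s · t) = cong₂ _·_ (substT-cong h s) (substT-cong h t)

exts-cong : ∀ {n m} {σ τ : Subst n m} → (∀ i → σ i ≡ τ i) → ∀ i → exts σ i ≡ exts τ i
exts-cong h zero = refl
exts-cong h (suc i) = cong wkT (h i)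

substF-cong : ∀ {n m} {σ τ : Subst n m} → (∀ i → σ i ≡ τ i) → ∀ φ → substF σ φ ≡ substF τ φ
substF-cong h ⊥̇ = refl
substF-cong h (s ≐ t) = cong₂ _≐_ (substT-cong h s) (substT-cong h t)
substF-cong h (s ⊑̇ t) = cong₂ _⊑̇_ (substT-cong h s) (substT-cong h t)
substF-cong h (φ ⇒ ψ) = cong₂ _⇒_ (substF-cong h φ) (substF-cong h ψ)
substF-cong h (φ ∧̇ ψ) = cong₂ _∧̇_ (substF-cong h φ) (substF-cong h ψ)
substF-cong h (φ ∨̇ ψ) = cong₂ _∨̇_ (substF-cong h φ) (substF-cong h ψ)
substF-cong h (∀̇ φ) = cong ∀̇ (substF-cong (exts-cong h) φ)
substF-cong h (∃̇ φ) = cong ∃̇ (substF-cong (exts-cong h) φ)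

substT-var : ∀ {n} (t : Term n) → substT var t ≡ t
substT-var (var i) = refl
substT-var e = refl
substT-var 𝟘 = refl
substT-var 𝟙 = refl
substT-var (s · t) = cong₂ _·_ (substT-var s) (substT-var t)

exts-var : ∀ {n} (i : Fin (suc n)) → exts var i ≡ var i
exts-var zero = refl
exts-var (suc i) = refl

substF-var : ∀ {n} (φ : Formula n) → substF var φ ≡ φ
substF-var ⊥̇ = refl
substF-var (s ≐ t) = cong₂ _≐_ (substT-var s) (substT-var t)
substF-var (s ⊑̇ t) = cong₂ _⊑̇_ (substT-var s) (substT-var t)
substF-var (φ ⇒ ψ) = cong₂ _⇒_ (substF-var φ) (substF-var ψ)
substF-var (φ ∧̇ ψ) = cong₂ _∧̇_ (substF-var φ) (substF-var ψ)
substF-var (φ ∨̇ ψ) = cong₂ _∨̇_ (substF-var φ) (substF-var ψ)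
substF-var (∀̇ φ) = cong ∀̇ (trans (substF-cong exts-var φ) (substF-var φ))
substF-var (∃̇ φ) = cong ∃̇ (trans (substF-cong exts-var φ) (substF-var φ))

substT-∘ : ∀ {n m k} (τ : Subst m k) (σ : Subst n m) t →
  substT τ (substT σ t) ≡ substT (λ i → substT τ (σ i)) t
substT-∘ τ σ (var i) = refl
substT-∘ τ σ e = refl
substT-∘ τ σ 𝟘 = refl
substT-∘ τ σ 𝟙 = refl
substT-∘ τ σ (s · t) = cong₂ _·_ (substT-∘ τ σ s) (substT-∘ τ σ t)

exts-∘ : ∀ {n m k} (τ : Subst m k) (σ : Subst n m) i →
  substT (exts τ) (exts σ i) ≡ exts (λ j → substT τ (σ j)) i
exts-∘ τ σ zero = refl
exts-∘ τ σ (suc i) = trans (substT-∘ (exts τ) (λ j → var (suc j)) (σ i))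
                           (sym (substT-∘ (λ j → var (suc j)) τ (σ i)))

substF-∘ : ∀ {n m k} (τ : Subst m k) (σ : Subst n m) φ →
  substF τ (substF σ φ) ≡ substF (λ i → substT τ (σ i)) φ
substF-∘ τ σ ⊥̇ = refl
substF-∘ τ σ (s ≐ t) = cong₂ _≐_ (substT-∘ τ σ s) (substT-∘ τ σ t)
substF-∘ τ σ (s ⊑̇ t) = cong₂ _⊑̇_ (substT-∘ τ σ s) (substT-∘ τ σ t)
substF-∘ τ σ (φ ⇒ ψ) = cong₂ _⇒_ (substF-∘ τ σ φ) (substF-∘ τ σ ψ)
substF-∘ τ σ (φ ∧̇ ψ) = cong₂ _∧̇_ (substF-∘ τ σ φ) (substF-∘ τ σ ψ)
substF-∘ τ σ (φ ∨̇ ψ) = cong₂ _∨̇_ (substF-∘ τ σ φ) (substF-∘ τ σ ψ)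
substF-∘ τ σ (∀̇ φ) = cong ∀̇ (trans (substF-∘ (exts τ) (exts σ) φ) (substF-cong (exts-∘ τ σ) φ))
substF-∘ τ σ (∃̇ φ) = cong ∃̇ (trans (substF-∘ (exts τ) (exts σ) φ) (substF-cong (exts-∘ τ σ) φ))

infixr 5 _▸_
_▸_ : ∀ {n m} → Term m → Subst n m → Subst (suc n) m
(u ▸ σ) zero = u
(u ▸ σ) (suc i) = σ i

∅ˢ : ∀ {m} → Subst 0 m
∅ˢ ()

substT-▸-wkT : ∀ {n m} (u : Term m) (σ : Subst n m) t → substT (u ▸ σ) (wkT t) ≡ substT σ t
substT-▸-wkT u σ t = substT-∘ (u ▸ σ) (λ j → var (suc j)) t

substF-exts-[] : ∀ {n m} (σ : Subst n m) (φ : Formula (suc n)) u →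
  substF (exts σ) φ [ u ] ≡ substF (u ▸ σ) φ
substF-exts-[] σ φ u = trans (substF-∘ _ (exts σ) φ) (substF-cong inst φ)
  where
  inst : ∀ i → substT _ (exts σ i) ≡ (u ▸ σ) i
  inst zero = refl
  inst (suc i) = trans (substT-∘ _ (λ j → var (suc j)) (σ i)) (substT-var (σ i))

closed-as-substF : (ψ : Formula 0) → ∀ {m} → closed {m} ψ ≡ substF ∅ˢ ψ
closed-as-substF ψ = substF-cong (λ ()) ψ



⊢-mono : ∀ {n} {Γ Δ : List (Formula n)} {φ} → Γ ⊆ Δ → Γ ⊢ φ → Δ ⊢ φ
⊢-mono f (hyp x) = hyp (f x)
⊢-mono f (ax a) = ax a
⊢-mono f (⇒I d) = ⇒I (⊢-mono (∷⁺ʳ _ f) d)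
⊢-mono f (⇒E d d₁) = ⇒E (⊢-mono f d) (⊢-mono f d₁)
⊢-mono f (∧I d d₁) = ∧I (⊢-mono f d) (⊢-mono f d₁)
⊢-mono f (∧E₁ d) = ∧E₁ (⊢-mono f d)
⊢-mono f (∧E₂ d) = ∧E₂ (⊢-mono f d)
⊢-mono f (∨I₁ d) = ∨I₁ (⊢-mono f d)
⊢-mono f (∨I₂ d) = ∨I₂ (⊢-mono f d)
⊢-mono f (∨E d d₁ d₂) = ∨E (⊢-mono f d) (⊢-mono (∷⁺ʳ _ f) d₁) (⊢-mono (∷⁺ʳ _ f) d₂)
⊢-mono f (raa d) = raa (⊢-mono (∷⁺ʳ _ f) d)
⊢-mono f (∀I d) = ∀I (⊢-mono (map⁺ wkF f) d)
⊢-mono f (∀E d t) = ∀E (⊢-mono f d) t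
⊢-mono f (∃I t d) = ∃I t (⊢-mono f d)
⊢-mono f (∃E d d₁) = ∃E (⊢-mono f d) (⊢-mono (∷⁺ʳ _ (map⁺ wkF f)) d₁)
⊢-mono f (≐refl t) = ≐refl t
⊢-mono f (≐subst φ d d₁) = ≐subst φ (⊢-mono f d) (⊢-mono f d₁)

⊢-weaken : ∀ {n} {Γ : List (Formula n)} {φ ψ} → Γ ⊢ φ → (ψ ∷ Γ) ⊢ φ
⊢-weaken = ⊢-mono (xs⊆x∷xs _ _)

variable
  m : ℕ
  Γ : List (Formula m)

⊥̇-elim : ∀ {φ} → Γ ⊢ ⊥̇ → Γ ⊢ φ
⊥̇-elim p = raa (⊢-weaken p)

∃E-wkF : ∀ {φ ψ ψ′} → wkF ψ ≡ ψ′ → Γ ⊢ ∃̇ φ → (φ ∷ map wkF Γ) ⊢ ψ′ → Γ ⊢ ψ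
∃E-wkF refl = ∃E

≐-substF : ∀ {k} (χ : Formula (suc k)) (σ : Subst k m) {s t} →
  Γ ⊢ s ≐ t → Γ ⊢ substF (s ▸ σ) χ → Γ ⊢ substF (t ▸ σ) χ
≐-substF χ σ {s} {t} p d = subst (_ ⊢_) (substF-exts-[] σ χ t)
  (≐subst (substF (exts σ) χ) p (subst (_ ⊢_) (sym (substF-exts-[] σ χ s)) d))

∀E-substF : ∀ {k} (χ : Formula (suc k)) (σ : Subst k m) →
  Γ ⊢ substF σ (∀̇ χ) → (u : Term m) → Γ ⊢ substF (u ▸ σ) χ
∀E-substF χ σ p u = subst (_ ⊢_) (substF-exts-[] σ χ u) (∀E p u)

ax-substF : ∀ {ψ} → AxF ψ → Γ ⊢ substF ∅ˢ ψ
ax-substF {ψ = ψ} a = subst (_ ⊢_) (closed-as-substF ψ) (ax a)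

private
  x₀ : ∀ {n} → Term (suc n)
  x₀ = var zero
  x₁ : ∀ {n} → Term (suc (suc n))
  x₁ = var (suc zero)
  x₂ : ∀ {n} → Term (suc (suc (suc n)))
  x₂ = var (suc (suc zero))

≐-sym : ∀ {s t} → Γ ⊢ s ≐ t → Γ ⊢ t ≐ s
≐-sym {s = s} p = ≐-substF (x₀ ≐ x₁) (s ▸ ∅ˢ) p (≐refl s)

≐-trans : ∀ {a b c} → Γ ⊢ a ≐ b → Γ ⊢ b ≐ c → Γ ⊢ a ≐ c
≐-trans {a = a} p q = ≐-substF (x₁ ≐ x₀) (a ▸ ∅ˢ) q p

·-congʳ : ∀ {a b} c → Γ ⊢ a ≐ b → Γ ⊢ a · c ≐ b · c
·-congʳ {a = a} c p = ≐-substF (x₁ · x₂ ≐ x₀ · x₂) (a ▸ c ▸ ∅ˢ) p (≐refl (a · c))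

·-congˡ : ∀ {a b} c → Γ ⊢ a ≐ b → Γ ⊢ c · a ≐ c · b
·-congˡ {a = a} c p = ≐-substF (x₂ · x₁ ≐ x₂ · x₀) (a ▸ c ▸ ∅ˢ) p (≐refl (c · a))

⊑-respˡ-≐ : ∀ {a b c} → Γ ⊢ a ≐ b → Γ ⊢ a ⊑̇ c → Γ ⊢ b ⊑̇ c
⊑-respˡ-≐ {c = c} p q = ≐-substF (x₀ ⊑̇ x₁) (c ▸ ∅ˢ) p q

⊑-respʳ-≐ : ∀ {a b c} → Γ ⊢ a ≐ b → Γ ⊢ c ⊑̇ a → Γ ⊢ c ⊑̇ b
⊑-respʳ-≐ {c = c} p q = ≐-substF (x₁ ⊑̇ x₀) (c ▸ ∅ˢ) p q

·-identityˡ : ∀ u → Γ ⊢ u ≐ e · u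
·-identityˡ u = ∧E₁ (∀E-substF ((x₀ ≐ e · x₀) ∧̇ (x₀ ≐ x₀ · e)) ∅ˢ (ax-substF ax1) u)

·-identityʳ : ∀ u → Γ ⊢ u ≐ u · e
·-identityʳ u = ∧E₂ (∀E-substF ((x₀ ≐ e · x₀) ∧̇ (x₀ ≐ x₀ · e)) ∅ˢ (ax-substF ax1) u)

·-assoc : ∀ a b c → Γ ⊢ (a · b) · c ≐ a · (b · c)
·-assoc a b c = ∀E-substF ((x₂ · x₁) · x₀ ≐ x₂ · (x₁ · x₀)) (b ▸ a ▸ ∅ˢ)
  (∀E-substF (∀̇ ((x₂ · x₁) · x₀ ≐ x₂ · (x₁ · x₀))) (a ▸ ∅ˢ)
    (∀E-substF (∀̇ (∀̇ ((x₂ · x₁) · x₀ ≐ x₂ · (x₁ · x₀)))) ∅ˢ (ax-substF ax2) a) b) c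

·-cancelʳ : ∀ a b → Γ ⊢ ¬̇ (a ≐ b) ⇒ (¬̇ (a · 𝟘 ≐ b · 𝟘) ∧̇ ¬̇ (a · 𝟙 ≐ b · 𝟙))
·-cancelʳ a b = ∀E-substF (¬̇ (x₁ ≐ x₀) ⇒ (¬̇ (x₁ · 𝟘 ≐ x₀ · 𝟘) ∧̇ ¬̇ (x₁ · 𝟙 ≐ x₀ · 𝟙))) (a ▸ ∅ˢ)
  (∀E-substF (∀̇ (¬̇ (x₁ ≐ x₀) ⇒ (¬̇ (x₁ · 𝟘 ≐ x₀ · 𝟘) ∧̇ ¬̇ (x₁ · 𝟙 ≐ x₀ · 𝟙)))) ∅ˢ (ax-substF ax3) a) b

·𝟘≢·𝟙 : ∀ a b → Γ ⊢ ¬̇ (a · 𝟘 ≐ b · 𝟙)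
·𝟘≢·𝟙 a b = ∀E-substF (¬̇ (x₁ · 𝟘 ≐ x₀ · 𝟙)) (a ▸ ∅ˢ) (∀E-substF (∀̇ (¬̇ (x₁ · 𝟘 ≐ x₀ · 𝟙))) ∅ˢ (ax-substF ax4) a) b

e⊑ : ∀ a → Γ ⊢ e ⊑̇ a
e⊑ a = ∀E-substF (e ⊑̇ x₀) ∅ˢ (ax-substF ax5) a

⊑e⇒≐e : ∀ a → Γ ⊢ (a ⊑̇ e) ⇒ (a ≐ e)
⊑e⇒≐e a = ∀E-substF ((x₀ ⊑̇ e) ⇒ (x₀ ≐ e)) ∅ˢ (ax-substF ax6) a

·bit-⊑-·bit : ∀ x y a b → Γ ⊢ (x · bit a ⊑̇ y · bit b) ⇔ (x ⊑̇ y)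
·bit-⊑-·bit {Γ = Γ} x y a b = subst (Γ ⊢_) (cong₂ (λ u v → (x · u ⊑̇ y · v) ⇔ (x ⊑̇ y)) (substT-bit a) (substT-bit b))
  (∀E-substF ((x₁ · bit a ⊑̇ x₀ · bit b) ⇔ (x₁ ⊑̇ x₀)) (x ▸ ∅ˢ)
    (∀E-substF (∀̇ ((x₁ · bit a ⊑̇ x₀ · bit b) ⇔ (x₁ ⊑̇ x₀))) ∅ˢ (ax-substF (ax7-10 a b)) x) y)
  where
  substT-bit : ∀ c → substT (y ▸ x ▸ ∅ˢ) (bit c) ≡ bit c
  substT-bit false = refl
  substT-bit true = refl

≐e-or-snoc : ∀ s → Γ ⊢ (s ≐ e) ∨̇ ∃̇ ((wkT s ≐ x₀ · 𝟘) ∨̇ (wkT s ≐ x₀ · 𝟙))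
≐e-or-snoc s = ∀E-substF ((x₀ ≐ e) ∨̇ ∃̇ ((x₁ ≐ x₀ · 𝟘) ∨̇ (x₁ ≐ x₀ · 𝟙))) ∅ˢ (ax-substF ax11) s

≢̇-sym : ∀ {a b} → Γ ⊢ ¬̇ (a ≐ b) → Γ ⊢ ¬̇ (b ≐ a)
≢̇-sym p = ⇒I (⇒E (⊢-weaken p) (≐-sym (hyp (here refl))))

-- a · 0 = e would give (1 a) 0 = 1 = e 1, and a · 1 = e would give e 0 = 0 = (0 a) 1.
·bit≢e : ∀ a c → Γ ⊢ ¬̇ (a · bit c ≐ e)
·bit≢e a false = ⇒I (⇒E (·𝟘≢·𝟙 (𝟙 · a) e)
  (≐-trans (·-assoc 𝟙 a 𝟘) (≐-trans (·-congˡ 𝟙 (hyp (here refl)))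
    (≐-trans (≐-sym (·-identityʳ 𝟙)) (·-identityˡ 𝟙)))))
·bit≢e a true = ≢̇-sym (⇒I (⇒E (·𝟘≢·𝟙 e (𝟘 · a))
  (≐-trans (≐-sym (·-identityˡ 𝟘)) (≐-trans (·-identityʳ 𝟘)
    (≐-trans (·-congˡ 𝟘 (hyp (here refl))) (≐-sym (·-assoc 𝟘 a 𝟙)))))))

·bit-≢-cong : ∀ {a b} c → Γ ⊢ ¬̇ (a ≐ b) → Γ ⊢ ¬̇ (a · bit c ≐ b · bit c)
·bit-≢-cong {a = a} {b} false p = ∧E₁ (⇒E (·-cancelʳ a b) p)
·bit-≢-cong {a = a} {b} true p = ∧E₂ (⇒E (·-cancelʳ a b) p)

-- The list is read backwards, so that consing a bit appends it on the right as in axioms 3, 4, 7–11.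
numeralʳ : ∀ {m} → List Bool → Term m
numeralʳ [] = e
numeralʳ (b ∷ r) = numeralʳ r · bit b

numeral : ∀ {m} → BitString → Term m
numeral α = numeralʳ (reverse α)

substT-numeralʳ : ∀ {n m} (σ : Subst n m) r → substT σ (numeralʳ r) ≡ numeralʳ r
substT-numeralʳ σ [] = refl
substT-numeralʳ σ (false ∷ r) = cong (_· 𝟘) (substT-numeralʳ σ r)
substT-numeralʳ σ (true ∷ r) = cong (_· 𝟙) (substT-numeralʳ σ r)

numeralʳ-≢ : ∀ r q → r ≢ q → Γ ⊢ ¬̇ (numeralʳ r ≐ numeralʳ q)
numeralʳ-≢ [] [] r≢q = ⊥-elim (r≢q refl)
numeralʳ-≢ [] (c ∷ q) _ = ≢̇-sym (·bit≢e (numeralʳ q) c)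
numeralʳ-≢ (b ∷ r) [] _ = ·bit≢e (numeralʳ r) b
numeralʳ-≢ (false ∷ r) (false ∷ q) r≢q = ·bit-≢-cong false (numeralʳ-≢ r q (λ eq → r≢q (cong (false ∷_) eq)))
numeralʳ-≢ (true ∷ r) (true ∷ q) r≢q = ·bit-≢-cong true (numeralʳ-≢ r q (λ eq → r≢q (cong (true ∷_) eq)))
numeralʳ-≢ (false ∷ r) (true ∷ q) _ = ·𝟘≢·𝟙 (numeralʳ r) (numeralʳ q)
numeralʳ-≢ (true ∷ r) (false ∷ q) _ = ≢̇-sym (·𝟘≢·𝟙 (numeralʳ q) (numeralʳ r))

numeralʳ-⊑ : ∀ r q → length r ≤ length q → Γ ⊢ numeralʳ r ⊑̇ numeralʳ q
numeralʳ-⊑ [] q _ = e⊑ (numeralʳ q)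
numeralʳ-⊑ (b ∷ r) (c ∷ q) (s≤s r≤q) = ⇒E (∧E₂ (·bit-⊑-·bit (numeralʳ r) (numeralʳ q) b c)) (numeralʳ-⊑ r q r≤q)

numeralʳ-⋢ : ∀ r q → length q < length r → Γ ⊢ ¬̇ (numeralʳ r ⊑̇ numeralʳ q)
numeralʳ-⋢ (b ∷ r) [] _ = ⇒I (⇒E (·bit≢e (numeralʳ r) b) (⇒E (⊑e⇒≐e (numeralʳ r · bit b)) (hyp (here refl))))
numeralʳ-⋢ (b ∷ r) (c ∷ q) (s≤s q<r) =
  ⇒I (⇒E (numeralʳ-⋢ r q q<r) (⇒E (∧E₁ (·bit-⊑-·bit (numeralʳ r) (numeralʳ q) b c)) (hyp (here refl))))

numeralʳ-++ : ∀ r q → Γ ⊢ numeralʳ r · numeralʳ q ≐ numeralʳ (q ++ r)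
numeralʳ-++ r [] = ≐-sym (·-identityʳ (numeralʳ r))
numeralʳ-++ r (b ∷ q) = ≐-trans (≐-sym (·-assoc (numeralʳ r) (numeralʳ q) (bit b))) (·-congʳ (bit b) (numeralʳ-++ r q))

numeral-· : ∀ α β → Γ ⊢ numeral α · numeral β ≐ numeral (α ++ β)
numeral-· {Γ = Γ} α β = subst (λ r → Γ ⊢ numeral α · numeral β ≐ numeralʳ r) (sym (reverse-++ α β))
  (numeralʳ-++ (reverse α) (reverse β))

numeralˢ : ∀ {n m} → Env n → Subst n m
numeralˢ ρ i = numeral (ρ i)

eval-numeral : ∀ {n} (t : Term n) (ρ : Env n) → Γ ⊢ substT (numeralˢ ρ) t ≐ numeral (⟦ t ⟧ₜ ρ)
eval-numeral (var i) ρ = ≐refl _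
eval-numeral e ρ = ≐refl e
eval-numeral 𝟘 ρ = ·-identityˡ 𝟘
eval-numeral 𝟙 ρ = ·-identityˡ 𝟙
eval-numeral (s · t) ρ = ≐-trans (·-congʳ _ (eval-numeral s ρ))
  (≐-trans (·-congˡ _ (eval-numeral t ρ)) (numeral-· (⟦ s ⟧ₜ ρ) (⟦ t ⟧ₜ ρ)))

numeral-≢ : ∀ α β → α ≢ β → Γ ⊢ ¬̇ (numeral α ≐ numeral β)
numeral-≢ α β α≢β = numeralʳ-≢ (reverse α) (reverse β) (λ eq → α≢β (reverse-injective eq))

numeral-⊑ : ∀ α β → length α ≤ length β → Γ ⊢ numeral α ⊑̇ numeral β
numeral-⊑ α β α≤β = numeralʳ-⊑ (reverse α) (reverse β)
  (subst₂ _≤_ (sym (length-reverse α)) (sym (length-reverse β)) α≤β)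

numeral-⋢ : ∀ α β → length β < length α → Γ ⊢ ¬̇ (numeral α ⊑̇ numeral β)
numeral-⋢ α β β<α = numeralʳ-⋢ (reverse α) (reverse β)
  (subst₂ _<_ (sym (length-reverse β)) (sym (length-reverse α)) β<α)

module _ {n} (s t : Term n) (ρ : Env n) where

  ⊑-complete : ρ ⊨ (s ⊑̇ t) → Γ ⊢ substF (numeralˢ ρ) (s ⊑̇ t)
  ⊑-complete s⊑t = ⊑-respˡ-≐ (≐-sym (eval-numeral s ρ)) (⊑-respʳ-≐ (≐-sym (eval-numeral t ρ)) (numeral-⊑ (⟦ s ⟧ₜ ρ) (⟦ t ⟧ₜ ρ) s⊑t))

  ⋢-complete : ¬ (ρ ⊨ (s ⊑̇ t)) → Γ ⊢ substF (numeralˢ ρ) (¬̇ (s ⊑̇ t))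
  ⋢-complete s⋢t = ⇒I (⇒E (numeral-⋢ (⟦ s ⟧ₜ ρ) (⟦ t ⟧ₜ ρ) (≰⇒> s⋢t))
    (⊑-respˡ-≐ (eval-numeral s ρ) (⊑-respʳ-≐ (eval-numeral t ρ) (hyp (here refl)))))

  ≐-complete : ρ ⊨ (s ≐ t) → Γ ⊢ substF (numeralˢ ρ) (s ≐ t)
  ≐-complete s≐t = ≐-trans (eval-numeral s ρ)
    (subst (λ γ → _ ⊢ numeral γ ≐ substT (numeralˢ ρ) t) (sym s≐t) (≐-sym (eval-numeral t ρ)))

  ≢-complete : ¬ (ρ ⊨ (s ≐ t)) → Γ ⊢ substF (numeralˢ ρ) (¬̇ (s ≐ t))
  ≢-complete s≢t = ⇒I (⇒E (numeral-≢ (⟦ s ⟧ₜ ρ) (⟦ t ⟧ₜ ρ) s≢t)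
    (≐-trans (≐-sym (eval-numeral s ρ)) (≐-trans (hyp (here refl)) (eval-numeral t ρ))))

oneOf : Term m → List (List Bool) → Formula m
oneOf s [] = ⊥̇
oneOf s (r ∷ rs) = (s ≐ numeralʳ r) ∨̇ oneOf s rs

wkF-oneOf : (s : Term m) (rs : List (List Bool)) → wkF (oneOf s rs) ≡ oneOf (wkT s) rs
wkF-oneOf s [] = refl
wkF-oneOf s (r ∷ rs) = cong₂ (λ u φ → (wkT s ≐ u) ∨̇ φ) (substT-numeralʳ _ r) (wkF-oneOf s rs)

oneOf-intro : ∀ {s r rs} → r ∈ rs → Γ ⊢ s ≐ numeralʳ r → Γ ⊢ oneOf s rs
oneOf-intro (here refl) p = ∨I₁ p
oneOf-intro (there r∈rs) p = ∨I₂ (oneOf-intro r∈rs p)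

oneOf-elim : ∀ {s rs φ} → Γ ⊢ oneOf s rs → (∀ {r} → r ∈ rs → (s ≐ numeralʳ r ∷ Γ) ⊢ φ) → Γ ⊢ φ
oneOf-elim {rs = []} p _ = ⊥̇-elim p
oneOf-elim {rs = r ∷ rs} p cases = ∨E p (cases (here refl))
  (oneOf-elim (hyp (here refl)) (λ r∈rs → ⊢-mono (∷⁺ʳ _ (xs⊆x∷xs _ _)) (cases (there r∈rs))))

oneOf-⊆ : ∀ {s rs qs} → rs ⊆ qs → Γ ⊢ oneOf s rs → Γ ⊢ oneOf s qs
oneOf-⊆ rs⊆qs p = oneOf-elim p (λ r∈rs → oneOf-intro (rs⊆qs r∈rs) (hyp (here refl)))

oneOf-snoc : ∀ {s y rs} a → Γ ⊢ s ≐ y · bit a → Γ ⊢ oneOf y rs → Γ ⊢ oneOf s (map (a ∷_) rs)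
oneOf-snoc a s≐ya p = oneOf-elim p (λ r∈rs →
  oneOf-intro (∈-map⁺ (a ∷_) r∈rs) (≐-trans (⊢-weaken s≐ya) (·-congʳ (bit a) (hyp (here refl)))))

upToLength : ℕ → List (List Bool)
upToLength zero = [] ∷ []
upToLength (suc k) = [] ∷ (map (false ∷_) (upToLength k) ++ map (true ∷_) (upToLength k))

∈-upToLength⇒≤ : ∀ {r} k → r ∈ upToLength k → length r ≤ k
∈-upToLength⇒≤ zero (here refl) = z≤n
∈-upToLength⇒≤ (suc k) (here refl) = z≤n
∈-upToLength⇒≤ (suc k) (there r∈) with ∈-++⁻ (map (false ∷_) (upToLength k)) r∈
... | inj₁ r∈₀ with ∈-map⁻ (false ∷_) r∈₀
...   | _ , q∈ , refl = s≤s (∈-upToLength⇒≤ k q∈)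
∈-upToLength⇒≤ (suc k) (there r∈) | inj₂ r∈₁ with ∈-map⁻ (true ∷_) r∈₁
...   | _ , q∈ , refl = s≤s (∈-upToLength⇒≤ k q∈)

map-∷-⊆-upToLength : ∀ a k → map (a ∷_) (upToLength k) ⊆ upToLength (suc k)
map-∷-⊆-upToLength false k = there ∘ xs⊆xs++ys _ _
map-∷-⊆-upToLength true k = there ∘ xs⊆ys++xs _ (map (false ∷_) (upToLength k))

-- Axiom 11 writes s as e or y · a, and axioms 7–10 carry the bound from s to y.
⊑numeralʳ⇒oneOf : ∀ q (s : Term m) → Γ ⊢ (s ⊑̇ numeralʳ q) ⇒ oneOf s (upToLength (length q))
⊑numeralʳ⇒oneOf [] s = ⇒I (∨I₁ (⇒E (⊑e⇒≐e s) (hyp (here refl))))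
⊑numeralʳ⇒oneOf {m = m} {Γ = Γ} (c ∷ q) s = ∨E (≐e-or-snoc s)
  (⇒I (∨I₁ (hyp (there (here refl)))))
  (∃E-wkF wkF-goal (hyp (here refl))
    (⇒I (∨E (hyp (there (here refl))) (snoc-case false) (snoc-case true))))
  where
  S : Term (suc m)
  S = wkT s
  wkF-goal : wkF ((s ⊑̇ numeralʳ (c ∷ q)) ⇒ oneOf s (upToLength (length (c ∷ q))))
           ≡ ((S ⊑̇ numeralʳ (c ∷ q)) ⇒ oneOf S (upToLength (length (c ∷ q))))
  wkF-goal = cong₂ (λ u φ → (S ⊑̇ u) ⇒ φ) (substT-numeralʳ _ (c ∷ q)) (wkF-oneOf s _)
  snoc-case : ∀ {Δ} a → (S ≐ x₀ · bit a ∷ (S ⊑̇ numeralʳ (c ∷ q)) ∷ Δ) ⊢ oneOf S (upToLength (length (c ∷ q)))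
  snoc-case a = oneOf-⊆ (map-∷-⊆-upToLength a (length q))
    (oneOf-snoc a (hyp (here refl)) (⇒E (⊑numeralʳ⇒oneOf q x₀) y⊑q))
    where
    y⊑q = ⇒E (∧E₁ (·bit-⊑-·bit x₀ (numeralʳ q) a c)) (⊑-respˡ-≐ (hyp (here refl)) (hyp (there (here refl))))

⟦wkT⟧ₜ : ∀ {n} (t : Term n) x (ρ : Env n) → ⟦ wkT t ⟧ₜ (x ∷ₑ ρ) ≡ ⟦ t ⟧ₜ ρ
⟦wkT⟧ₜ (var i) x ρ = refl
⟦wkT⟧ₜ e x ρ = refl
⟦wkT⟧ₜ 𝟘 x ρ = refl
⟦wkT⟧ₜ 𝟙 x ρ = refl
⟦wkT⟧ₜ (s · t) x ρ = cong₂ _++_ (⟦wkT⟧ₜ s x ρ) (⟦wkT⟧ₜ t x ρ)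

module _ {n} (ρ : Env n) where

  numeralˢ-∷ₑ : ∀ {m} x (i : Fin (suc n)) → (numeral x ▸ numeralˢ ρ) i ≡ numeralˢ {m = m} (x ∷ₑ ρ) i
  numeralˢ-∷ₑ x zero = refl
  numeralˢ-∷ₑ x (suc i) = refl

  exts-numeralˢ : ∀ {m} (i : Fin (suc n)) → exts {m = m} (numeralˢ ρ) i ≡ (x₀ ▸ numeralˢ ρ) i
  exts-numeralˢ zero = refl
  exts-numeralˢ (suc i) = substT-numeralʳ _ (reverse (ρ i))

  ∃-complete : ∀ (φ : Formula (suc n)) x →
    Γ ⊢ substF (numeralˢ (x ∷ₑ ρ)) φ → Γ ⊢ substF (numeralˢ ρ) (∃̇ φ)
  ∃-complete {Γ = Γ} φ x d = ∃I (numeral x) (subst (Γ ⊢_)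
    (sym (trans (substF-exts-[] (numeralˢ ρ) φ (numeral x)) (substF-cong (numeralˢ-∷ₑ x) φ))) d)

  b∀-complete : ∀ {m} {Γ : List (Formula m)} t (φ : Formula (suc n)) →
    (∀ x → length x ≤ length (⟦ t ⟧ₜ ρ) → ∀ {k} {Δ : List (Formula k)} → Δ ⊢ substF (numeralˢ (x ∷ₑ ρ)) φ) →
    Γ ⊢ substF (numeralˢ ρ) (∀̇ ((x₀ ⊑̇ wkT t) ⇒ φ))
  b∀-complete {m = m} {Γ = Γ} t φ instances =
    ∀I (⇒I (oneOf-elim (⇒E (⊑numeralʳ⇒oneOf q x₀) x⊑q) case))
    where
    q = reverse (⟦ t ⟧ₜ ρ)
    Δ = (x₀ ⊑̇ substT (exts (numeralˢ ρ)) (wkT t)) ∷ map wkF Γ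
    substT-exts-wkT : substT (exts {m = m} (numeralˢ ρ)) (wkT t) ≡ substT (numeralˢ ρ) t
    substT-exts-wkT = trans (substT-cong exts-numeralˢ (wkT t)) (substT-▸-wkT x₀ (numeralˢ ρ) t)
    x⊑q : Δ ⊢ x₀ ⊑̇ numeralʳ q
    x⊑q = ⊑-respʳ-≐ (eval-numeral t ρ) (subst (λ u → Δ ⊢ x₀ ⊑̇ u) substT-exts-wkT (hyp (here refl)))
    case : ∀ {r} → r ∈ upToLength (length q) → (x₀ ≐ numeralʳ r ∷ Δ) ⊢ substF (exts (numeralˢ ρ)) φ
    case {r} r∈ = subst (x₀ ≐ numeralʳ r ∷ Δ ⊢_) (sym (substF-cong exts-numeralˢ φ))
      (≐-substF φ (numeralˢ ρ) (≐-sym (hyp (here refl)))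
        (subst (x₀ ≐ numeralʳ r ∷ Δ ⊢_) (substF-cong numeralʳ-∷ₑ φ) (instances (reverse r) reverse-r≤t)))
      where
      numeralʳ-∷ₑ : ∀ i → numeralˢ (reverse r ∷ₑ ρ) i ≡ (numeralʳ r ▸ numeralˢ ρ) i
      numeralʳ-∷ₑ zero = cong numeralʳ (reverse-involutive r)
      numeralʳ-∷ₑ (suc i) = refl
      reverse-r≤t : length (reverse r) ≤ length (⟦ t ⟧ₜ ρ)
      reverse-r≤t = subst₂ _≤_ (sym (length-reverse r)) (length-reverse (⟦ t ⟧ₜ ρ))
        (∈-upToLength⇒≤ (length q) r∈)

Σ-complete : ∀ {n} {φ : Formula n} → IsΣ φ → (ρ : Env n) → ρ ⊨ φ →
  ∀ {m} {Γ : List (Formula m)} → Γ ⊢ substF (numeralˢ ρ) φ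
Σ-complete (⊑-atom s t) ρ h = ⊑-complete s t ρ h
Σ-complete (⊑-neg s t) ρ h = ⋢-complete s t ρ h
Σ-complete (≐-atom s t) ρ h = ≐-complete s t ρ h
Σ-complete (≐-neg s t) ρ h = ≢-complete s t ρ h
Σ-complete (∧-Σ p q) ρ (hp , hq) = ∧I (Σ-complete p ρ hp) (Σ-complete q ρ hq)
Σ-complete (∨-Σ p q) ρ (inj₁ hp) = ∨I₁ (Σ-complete p ρ hp)
Σ-complete (∨-Σ p q) ρ (inj₂ hq) = ∨I₂ (Σ-complete q ρ hq)
Σ-complete (∃-Σ {φ} p) ρ (x , hx) = ∃-complete ρ φ x (Σ-complete p (x ∷ₑ ρ) hx)
Σ-complete (b∃-Σ t {φ} p) ρ (x , x⊑t , hx) = ∃-complete ρ ((x₀ ⊑̇ wkT t) ∧̇ φ) x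
  (∧I (⊑-complete x₀ (wkT t) (x ∷ₑ ρ) x⊑t) (Σ-complete p (x ∷ₑ ρ) hx))
Σ-complete (b∀-Σ t {φ} p) ρ h = b∀-complete ρ t φ (λ x x⊑t →
  Σ-complete p (x ∷ₑ ρ) (h x (subst (length x ≤_) (cong length (sym (⟦wkT⟧ₜ t x ρ))) x⊑t)))

theorem6 : (φ : Formula 0) → IsΣ φ → 𝔉⊨ φ → F⊢ φ
theorem6 φ φ∈Σ 𝔉⊨φ = subst ([] ⊢_) substF-∅ˢ (Σ-complete φ∈Σ (λ ()) 𝔉⊨φ)
  where
  substF-∅ˢ : substF (numeralˢ (λ ())) φ ≡ φ
  substF-∅ˢ = trans (substF-cong (λ ()) φ) (substF-var φ)
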